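{- If $G$ is an appended star of order $n$ and of maximum degree $\Delta\ge4$, then $\gamma^{\rm ID}(G)\le\left(\frac{\Delta-1}{\Delta}\right)n$.
   Context: A $\Delta$-star is $K_{1,\Delta}$. $G'\rhd_v S$ denotes the graph obtained from the disjoint union of $G'$ and a star $S$ by identifying the vertex $v$ of $G'$ with a leaf of $S$. An appended star is a graph $G_p$ where $p\ge1$, $G_0=S_0$ is a $\Delta_0$-star with $\Delta_0\ge3$, and $G_i=G_{i-1}\rhd_{v_{i-1}}S_i$ for $i=1,\dots,p$, with $S_i$ a $\Delta_i$-star, $\Delta_i\ge3$, and $v_{i-1}$ a vertex of $G_{i-1}$. An identifying code of $G$ is a set $C\subseteq V(G)$ such that every vertex $v$ satisfies $N[v]\cap C\neq\emptyset$ and distinct vertices $u,v$ satisfy $N[u]\cap C\neq N[v]\cap C$, where $N[v]$ is the closed neighborhood; $\gamma^{\rm ID}(G)$ is its minimum size. -}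

module Defs where

open import Data.Nat using (ℕ; zero; suc; _+_; _*_; _∸_; _≤_; _<_; _≟_)
open import Data.List using (List; []; _∷_; _++_; map; upTo; length; filter)
open import Data.List.Membership.Propositional using (_∈_)
open import Data.List.Relation.Unary.All using (All)
open import Data.List.Relation.Unary.Unique.Propositional using (Unique)
open import Data.Product using (_×_; _,_; proj₁; proj₂; ∃; ∃-syntax)
open import Data.Sum using (_⊎_)
open import Relation.Nullary using (¬_)
open import Relation.Nullary.Decidable using (_⊎-dec_)
open import Relation.Binary.PropositionalEquality using (_≡_; _≢_)
open import Function.Bundles using (_⇔_)

-- A finite simple graph on vertex set {0,…,n-1} given by a list of edges.
Edges : Set
Edges = List (ℕ × ℕ)

starFrom : ℕ → ℕ → Edges
starFrom c d = map (λ i → (c , c + suc i)) (upTo d)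

-- AppendedStarSeq p n E : E is the edge list of G_p (on vertices 0..n-1)
-- obtained after p appending steps.  Each new Δ-star S_i gets a fresh
-- centre n (n = current order), one leaf identified with an existing
-- vertex v < n, and fresh leaves n+1, …, n+Δ-1.  (Up to isomorphism this is
-- exactly the construction G_i = G_{i-1} ▷_{v} S_i.)
data AppendedStarSeq : ℕ → ℕ → Edges → Set where
  base   : (d : ℕ) → 3 ≤ d → AppendedStarSeq 0 (suc d) (starFrom 0 d)
  append : ∀ {p n E} → AppendedStarSeq p n E →
           (d : ℕ) → 3 ≤ d → (v : ℕ) → v < n →
           AppendedStarSeq (suc p) (n + d)
             (E ++ ((n , v) ∷ starFrom n (d ∸ 1)))

AppendedStar : ℕ → Edges → Set
AppendedStar n E = ∃[ p ] (1 ≤ p × AppendedStarSeq p n E)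

Adj : Edges → ℕ → ℕ → Set
Adj E u w = (u , w) ∈ E ⊎ (w , u) ∈ E

InClosedNbhd : Edges → ℕ → ℕ → Set
InClosedNbhd E v w = w ≡ v ⊎ Adj E v w

-- degree of v: number of edges incident to v (graphs here are simple)
degree : Edges → ℕ → ℕ
degree E v = length (filter (λ e → (proj₁ e ≟ v) ⊎-dec (proj₂ e ≟ v)) E)

MaxDegree : ℕ → Edges → ℕ → Set
MaxDegree n E Δ =
  (∀ v → v < n → degree E v ≤ Δ) × (∃[ v ] (v < n × degree E v ≡ Δ))

IsIdentifyingCode : ℕ → Edges → List ℕ → Set
IsIdentifyingCode n E C =
  Unique C × All (_< n) C ×
  (∀ v → v < n → ∃[ c ] (c ∈ C × InClosedNbhd E v c)) ×
  (∀ u v → u < n → v < n → u ≢ v →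
     ¬ (∀ c → c ∈ C → (InClosedNbhd E u c ⇔ InClosedNbhd E v c)))

-- γ^ID(G) * Δ ≤ (Δ - 1) * n, i.e. some identifying code has size k with
-- k ≤ ((Δ-1)/Δ) n  (γ^ID is the minimum size of an identifying code).

-- Attaching a d-star (d ≤ Δ) at an old vertex adds d vertices, d - 1 ≥ 2 of them fresh leaves, and
-- an identifying code of the old graph together with the fresh leaves identifies the new graph: each
-- fresh leaf witnesses itself, the new centre is the only vertex adjacent to two of them, and old
-- vertices see none of them. So every attachment after the first keeps the ratio (Δ - 1)/Δ.
-- For G₁ = S₀ ▷ S₁ the set of all leaves is within that ratio unless both stars are Δ-stars. Then
-- take both centres and all leaves except the leaf ℓ of S₀ carrying S₁, one more leaf of S₀ and one
-- leaf of S₁: 2Δ - 2 of 2Δ + 1 vertices. The centre of S₀ tells S₀ from S₁, the centre of S₁ tells ℓ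
-- from the rest of S₀, and inside each star a code centre, two code leaves (this is where Δ ≥ 4 is
-- needed) and one non-code leaf are pairwise separated.

module Submission where

open import Defs
open import Data.Nat using (ℕ; zero; suc; _+_; _*_; _∸_; _≤_; _<_; _≟_; _<?_; z≤n; s≤s)
open import Data.Nat.Properties
open import Data.Nat.Tactic.RingSolver using (solve-∀)
open import Data.List using (List; []; _∷_; _++_; map; upTo; length; filter)
open import Data.List.Properties using (length-map; length-++; length-upTo; filter-++; filter-all; filter-accept; filter-notAll)
open import Data.List.Membership.Propositional using (_∈_)
open import Data.List.Membership.Propositional.Properties using (∈-map⁺; ∈-map⁻; ∈-upTo⁺; ∈-upTo⁻; ∈-++⁺ˡ; ∈-++⁺ʳ; ∈-++⁻; ∈-filter⁺; ∈-filter⁻)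
open import Data.List.Relation.Unary.Any as Any using (here; there)
open import Data.List.Relation.Unary.All as All using (All; []; _∷_)
open import Data.List.Relation.Unary.All.Properties as All using ()
open import Data.List.Relation.Unary.AllPairs using ([]; _∷_)
open import Data.List.Relation.Unary.Unique.Propositional using (Unique)
open import Data.List.Relation.Unary.Unique.Propositional.Properties as Unique using ()
open import Data.Product using (_×_; _,_; proj₁; proj₂; ∃-syntax)
open import Data.Sum using (_⊎_; inj₁; inj₂; [_,_]′)
open import Data.Empty using (⊥-elim)
open import Relation.Nullary using (¬_; Dec; yes; no)
open import Relation.Nullary.Decidable using (¬?; _×-dec_; _⊎-dec_)
open import Relation.Binary.Definitions using (tri<; tri≈; tri>)
open import Relation.Binary.PropositionalEquality using (_≡_; _≢_; refl; sym; trans; cong; subst; subst₂; ≢-sym)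
open import Function.Bundles using (_⇔_; mk⇔; Equivalence)

leaves : ℕ → ℕ → List ℕ
leaves c d = map (λ i → c + suc i) (upTo d)

private
  leaf-index : ∀ {c w d} → c < w → w ≤ c + d → ∃[ i ] (i < d × w ≡ c + suc i)
  leaf-index {c} {w} {d} c<w w≤c+d = i , +-cancelˡ-≤ c (suc i) d (subst (_≤ c + d) w≡ w≤c+d) , w≡
    where
    i = w ∸ suc c
    w≡ : w ≡ c + suc i
    w≡ = trans (sym (m+[n∸m]≡n c<w)) (sym (+-suc c i))

  leaf-bounds : ∀ {c i d} → i < d → c < c + suc i × c + suc i ≤ c + d
  leaf-bounds {c} i<d = m<m+n c (s≤s z≤n) , +-monoʳ-≤ c i<d

∈-leaves⁺ : ∀ {c w d} → c < w → w ≤ c + d → w ∈ leaves c d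
∈-leaves⁺ {c} c<w w≤c+d with leaf-index c<w w≤c+d
... | i , i<d , refl = ∈-map⁺ (λ i → c + suc i) (∈-upTo⁺ i<d)

∈-leaves⁻ : ∀ {c w d} → w ∈ leaves c d → c < w × w ≤ c + d
∈-leaves⁻ {c} w∈ with ∈-map⁻ (λ i → c + suc i) w∈
... | i , i∈ , refl = leaf-bounds (∈-upTo⁻ i∈)

∈-starFrom⁺ : ∀ {c w d} → c < w → w ≤ c + d → (c , w) ∈ starFrom c d
∈-starFrom⁺ {c} c<w w≤c+d with leaf-index c<w w≤c+d
... | i , i<d , refl = ∈-map⁺ (λ i → (c , c + suc i)) (∈-upTo⁺ i<d)

∈-starFrom⁻ : ∀ {a b c d} → (a , b) ∈ starFrom c d → a ≡ c × c < b × b ≤ c + d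
∈-starFrom⁻ {c = c} e∈ with ∈-map⁻ (λ i → (c , c + suc i)) e∈
... | i , i∈ , refl = refl , leaf-bounds (∈-upTo⁻ i∈)

length-leaves : ∀ c d → length (leaves c d) ≡ d
length-leaves c d = trans (length-map _ (upTo d)) (length-upTo d)

leaves-unique : ∀ c d → Unique (leaves c d)
leaves-unique c d = Unique.map⁺ (λ eq → suc-injective (+-cancelˡ-≡ c _ _ eq)) (Unique.upTo⁺ d)

without : ℕ → List ℕ → List ℕ
without a = filter (λ x → ¬? (x ≟ a))

∈-without⁺ : ∀ {a x xs} → x ∈ xs → x ≢ a → x ∈ without a xs
∈-without⁺ = ∈-filter⁺ _

∈-without⁻ : ∀ {a x xs} → x ∈ without a xs → x ∈ xs × x ≢ a
∈-without⁻ = ∈-filter⁻ _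

length-without : ∀ {a xs} → a ∈ xs → suc (length (without a xs)) ≤ length xs
length-without {a} {xs} a∈ = filter-notAll _ xs (Any.map (λ { refl x≢x → x≢x refl }) a∈)

without-unique : ∀ {a xs} → Unique xs → Unique (without a xs)
without-unique = Unique.filter⁺ _

IncidentTo : ℕ → ℕ × ℕ → Set
IncidentTo v e = proj₁ e ≡ v ⊎ proj₂ e ≡ v

incident? : ∀ v e → Dec (IncidentTo v e)
incident? v e = (proj₁ e ≟ v) ⊎-dec (proj₂ e ≟ v)

degree-++ : ∀ xs ys v → degree (xs ++ ys) v ≡ degree xs v + degree ys v
degree-++ xs ys v = trans (cong length (filter-++ (incident? v) xs ys)) (length-++ (filter (incident? v) xs))

degree-++ˡ : ∀ xs ys v → degree xs v ≤ degree (xs ++ ys) v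
degree-++ˡ xs ys v = subst (degree xs v ≤_) (sym (degree-++ xs ys v)) (m≤m+n _ _)

degree-∷ : ∀ {e} es v → IncidentTo v e → degree (e ∷ es) v ≡ suc (degree es v)
degree-∷ es v e∋v = cong length (filter-accept (incident? v) e∋v)

degree-starFrom : ∀ c d → degree (starFrom c d) c ≡ d
degree-starFrom c d =
  trans (cong length (filter-all (incident? c) {starFrom c d} (All.tabulate (λ e∈ → inj₁ (proj₁ (∈-starFrom⁻ e∈))))))
        (trans (length-map _ (upTo d)) (length-upTo d))

degree-attached-centre : ∀ E {n v} e → suc e ≤ degree (E ++ ((n , v) ∷ starFrom n e)) n
degree-attached-centre E {n} {v} e = begin
  suc e                                            ≡⟨ cong suc (sym (degree-starFrom n e)) ⟩
  suc (degree (starFrom n e) n)                    ≤⟨ m≤n+m _ (degree E n) ⟩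
  degree E n + suc (degree (starFrom n e) n)       ≡⟨ cong (degree E n +_) (sym (degree-∷ {n , v} (starFrom n e) n (inj₁ refl))) ⟩
  degree E n + degree ((n , v) ∷ starFrom n e) n   ≡⟨ sym (degree-++ E _ n) ⟩
  degree (E ++ ((n , v) ∷ starFrom n e)) n         ∎
  where open ≤-Reasoning

degree-attached-anchor : ∀ E {n v} F → suc (degree E v) ≤ degree (E ++ ((n , v) ∷ F)) v
degree-attached-anchor E {n} {v} F = begin
  suc (degree E v)                    ≤⟨ s≤s (m≤m+n _ _) ⟩
  suc (degree E v + degree F v)       ≡⟨ sym (+-suc _ _) ⟩
  degree E v + suc (degree F v)       ≡⟨ cong (degree E v +_) (sym (degree-∷ {n , v} F v (inj₂ refl))) ⟩
  degree E v + degree ((n , v) ∷ F) v ≡⟨ sym (degree-++ E _ v) ⟩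
  degree (E ++ ((n , v) ∷ F)) v       ∎
  where open ≤-Reasoning

SameTrace : Edges → List ℕ → ℕ → ℕ → Set
SameTrace E C u v = ∀ c → c ∈ C → (InClosedNbhd E u c ⇔ InClosedNbhd E v c)

SameTrace-sym : ∀ {E C u v} → SameTrace E C u v → SameTrace E C v u
SameTrace-sym H c c∈ = mk⇔ (Equivalence.from (H c c∈)) (Equivalence.to (H c c∈))

transfer : ∀ {E C u v c} → SameTrace E C u v → c ∈ C → InClosedNbhd E u c → InClosedNbhd E v c
transfer H c∈ = Equivalence.to (H _ c∈)

separated-by : ∀ {E C u v c} → c ∈ C → InClosedNbhd E u c → ¬ InClosedNbhd E v c → ¬ SameTrace E C u v
separated-by c∈ u∼c v≁c H = v≁c (transfer H c∈ u∼c)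

Adj-sym : ∀ {E u w} → Adj E u w → Adj E w u
Adj-sym (inj₁ e) = inj₂ e
Adj-sym (inj₂ e) = inj₁ e

EdgesBelow : ℕ → Edges → Set
EdgesBelow n E = ∀ {a b} → (a , b) ∈ E → a < n × b < n

EdgesFrom : ℕ → Edges → Set
EdgesFrom n X = ∀ {a b} → (a , b) ∈ X → a ≡ n × b < n

nbhd-sym : ∀ {E u c} → InClosedNbhd E u c → InClosedNbhd E c u
nbhd-sym (inj₁ eq) = inj₁ (sym eq)
nbhd-sym (inj₂ a) = inj₂ (Adj-sym a)

nbhd-below : ∀ {n E u c} → EdgesBelow n E → u < n → InClosedNbhd E u c → c < n
nbhd-below below u<n (inj₁ refl) = u<n
nbhd-below below u<n (inj₂ (inj₁ e∈)) = proj₂ (below e∈)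
nbhd-below below u<n (inj₂ (inj₂ e∈)) = proj₁ (below e∈)

single-edge-from : ∀ {n v} → v < n → EdgesFrom n ((n , v) ∷ [])
single-edge-from v<n (here refl) = refl , v<n

empty-code : IsIdentifyingCode 0 [] []
empty-code = [] , [] , (λ _ ()) , (λ _ _ ())

-- Appending a star

module Append (n : ℕ) (E X : Edges) (m : ℕ) (E-below : EdgesBelow n E) (X-from : EdgesFrom n X) where

  E′ : Edges
  E′ = E ++ (X ++ starFrom n m)

  N′ : ℕ → ℕ → Set
  N′ = InClosedNbhd E′

  Fresh : ℕ → Set
  Fresh w = n < w × w ≤ n + m

  data Place (u : ℕ) : Set where
    old    : u < n → Place u
    centre : u ≡ n → Place u
    fresh  : Fresh u → Place u

  <order⇒≤n+m : ∀ {w} → w < n + suc m → w ≤ n + m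
  <order⇒≤n+m {w} w< = ≤-pred (subst (w <_) (+-suc n m) w<)

  place : ∀ {u} → u < n + suc m → Place u
  place {u} u< with <-cmp u n
  ... | tri< u<n _ _ = old u<n
  ... | tri≈ _ u≡n _ = centre u≡n
  ... | tri> _ _ n<u = fresh (n<u , <order⇒≤n+m u<)

  edge-cases : ∀ {a b} → (a , b) ∈ E′ → (a , b) ∈ E ⊎ (a , b) ∈ X ⊎ (a ≡ n × Fresh b)
  edge-cases e∈ with ∈-++⁻ E e∈
  ... | inj₁ e∈E = inj₁ e∈E
  ... | inj₂ e∈′ with ∈-++⁻ X e∈′
  ... | inj₁ e∈X = inj₂ (inj₁ e∈X)
  ... | inj₂ e∈S = inj₂ (inj₂ (∈-starFrom⁻ e∈S))

  old<order : ∀ {a} → a < n → a < n + suc m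
  old<order a<n = <-≤-trans a<n (m≤m+n n (suc m))

  n<order : n < n + suc m
  n<order = m<m+n n (s≤s z≤n)

  fresh<order : ∀ {w} → w ≤ n + m → w < n + suc m
  fresh<order w≤ = ≤-<-trans w≤ (+-monoʳ-< n (n<1+n m))

  edges-below : EdgesBelow (n + suc m) E′
  edges-below e∈ with edge-cases e∈
  ... | inj₁ e∈E = old<order (proj₁ (E-below e∈E)) , old<order (proj₂ (E-below e∈E))
  ... | inj₂ (inj₁ e∈X) with X-from e∈X
  ... | refl , b<n = n<order , old<order b<n
  edges-below e∈ | inj₂ (inj₂ (refl , _ , b≤)) = n<order , fresh<order b≤

  lift-nbhd : ∀ {u c} → InClosedNbhd E u c → N′ u c
  lift-nbhd (inj₁ eq) = inj₁ eq
  lift-nbhd (inj₂ (inj₁ e∈)) = inj₂ (inj₁ (∈-++⁺ˡ e∈))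
  lift-nbhd (inj₂ (inj₂ e∈)) = inj₂ (inj₂ (∈-++⁺ˡ e∈))

  centre-adj-fresh : ∀ {w} → Fresh w → Adj E′ n w
  centre-adj-fresh (n<w , w≤) = inj₁ (∈-++⁺ʳ E (∈-++⁺ʳ X (∈-starFrom⁺ n<w w≤)))

  centre-adj-X : ∀ {b} → (n , b) ∈ X → Adj E′ n b
  centre-adj-X e∈ = inj₁ (∈-++⁺ʳ E (∈-++⁺ˡ e∈))

  adj-fresh : ∀ {x w} → n < w → Adj E′ x w → x ≡ n
  adj-fresh n<w (inj₁ e∈) with edge-cases e∈
  ... | inj₁ e∈E = ⊥-elim (<-asym n<w (proj₂ (E-below e∈E)))
  ... | inj₂ (inj₁ e∈X) = ⊥-elim (<-asym n<w (proj₂ (X-from e∈X)))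
  ... | inj₂ (inj₂ (x≡n , _)) = x≡n
  adj-fresh n<w (inj₂ e∈) with edge-cases e∈
  ... | inj₁ e∈E = ⊥-elim (<-asym n<w (proj₁ (E-below e∈E)))
  ... | inj₂ (inj₁ e∈X) = ⊥-elim (<-irrefl (sym (proj₁ (X-from e∈X))) n<w)
  ... | inj₂ (inj₂ (w≡n , _)) = ⊥-elim (<-irrefl (sym w≡n) n<w)

  fresh-nbhd : ∀ {w c} → n < w → N′ w c → c ≡ w ⊎ c ≡ n
  fresh-nbhd n<w (inj₁ eq) = inj₁ eq
  fresh-nbhd n<w (inj₂ a) = inj₂ (adj-fresh n<w (Adj-sym a))

  old-nbhd⁻ : ∀ {u c} → u < n → N′ u c → InClosedNbhd E u c ⊎ (c ≡ n × (n , u) ∈ X)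
  old-nbhd⁻ u<n (inj₁ eq) = inj₁ (inj₁ eq)
  old-nbhd⁻ u<n (inj₂ (inj₁ e∈)) with edge-cases e∈
  ... | inj₁ e∈E = inj₁ (inj₂ (inj₁ e∈E))
  ... | inj₂ (inj₁ e∈X) = ⊥-elim (<-irrefl (proj₁ (X-from e∈X)) u<n)
  ... | inj₂ (inj₂ (u≡n , _)) = ⊥-elim (<-irrefl u≡n u<n)
  old-nbhd⁻ u<n (inj₂ (inj₂ e∈)) with edge-cases e∈
  ... | inj₁ e∈E = inj₁ (inj₂ (inj₂ e∈E))
  ... | inj₂ (inj₁ e∈X) with X-from e∈X
  ... | refl , _ = inj₂ (refl , e∈X)
  old-nbhd⁻ u<n (inj₂ (inj₂ e∈)) | inj₂ (inj₂ (_ , n<u , _)) = ⊥-elim (<-asym u<n n<u)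

  old-nbhd : ∀ {u c} → u < n → c < n → N′ u c → InClosedNbhd E u c
  old-nbhd u<n c<n u∼c with old-nbhd⁻ u<n u∼c
  ... | inj₁ u∼₀c = u∼₀c
  ... | inj₂ (c≡n , _) = ⊥-elim (<-irrefl c≡n c<n)

  old-nbhd-fresh : ∀ {u w} → u < n → n < w → ¬ N′ u w
  old-nbhd-fresh u<n n<w u∼w with old-nbhd⁻ u<n u∼w
  ... | inj₁ u∼₀w = <-asym n<w (nbhd-below E-below u<n u∼₀w)
  ... | inj₂ (w≡n , _) = <-irrefl (sym w≡n) n<w

  module Extend {C : List ℕ} (code : IsIdentifyingCode n E C) (2≤m : 2 ≤ m) where

    C′ : List ℕ
    C′ = C ++ leaves n m

    private
      C-unique : Unique C
      C-unique = proj₁ code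

      C-below : All (_< n) C
      C-below = proj₁ (proj₂ code)

      C-dominating : ∀ w → w < n → ∃[ c ] (c ∈ C × InClosedNbhd E w c)
      C-dominating = proj₁ (proj₂ (proj₂ code))

      C-separating : ∀ u v → u < n → v < n → u ≢ v → ¬ SameTrace E C u v
      C-separating = proj₂ (proj₂ (proj₂ code))

    fresh∈C′ : ∀ {w} → Fresh w → w ∈ C′
    fresh∈C′ (n<w , w≤) = ∈-++⁺ʳ C (∈-leaves⁺ n<w w≤)

    first-fresh : Fresh (n + 1)
    first-fresh = m<m+n n (s≤s z≤n) , +-monoʳ-≤ n (≤-trans (s≤s z≤n) 2≤m)

    another-fresh : ∀ v → ∃[ w ] (Fresh w × w ≢ v)
    another-fresh v with v ≟ n + 1
    ... | yes refl = n + 2 , (m<m+n n (s≤s z≤n) , +-monoʳ-≤ n 2≤m) , λ eq → 1+n≢n (+-cancelˡ-≡ n 2 1 eq)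
    ... | no v≢n+1 = n + 1 , first-fresh , λ eq → v≢n+1 (sym eq)

    restrict : ∀ {u v} → u < n → v < n → SameTrace E′ C′ u v → SameTrace E C u v
    restrict u<n v<n H c c∈ = mk⇔
      (λ u∼c → old-nbhd v<n (All.lookup C-below c∈) (transfer H (∈-++⁺ˡ c∈) (lift-nbhd u∼c)))
      (λ v∼c → old-nbhd u<n (All.lookup C-below c∈) (transfer (SameTrace-sym H) (∈-++⁺ˡ c∈) (lift-nbhd v∼c)))

    old-identified : ∀ {u v} → u < n → v < n → SameTrace E′ C′ u v → u ≡ v
    old-identified {u} {v} u<n v<n H with u ≟ v
    ... | yes u≡v = u≡v
    ... | no u≢v = ⊥-elim (C-separating u v u<n v<n u≢v (restrict u<n v<n H))

    fresh≁old : ∀ {u v} → Fresh u → v < n → ¬ SameTrace E′ C′ u v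
    fresh≁old u-fresh v<n = separated-by (fresh∈C′ u-fresh) (inj₁ refl) (old-nbhd-fresh v<n (proj₁ u-fresh))

    centre≁old : ∀ {v} → v < n → ¬ SameTrace E′ C′ n v
    centre≁old v<n = separated-by (fresh∈C′ first-fresh) (inj₂ (centre-adj-fresh first-fresh))
                                  (old-nbhd-fresh v<n (proj₁ first-fresh))

    centre≁fresh : ∀ {v} → Fresh v → ¬ SameTrace E′ C′ n v
    centre≁fresh {v} (n<v , _) with another-fresh v
    ... | w , w-fresh , w≢v = separated-by (fresh∈C′ w-fresh) (inj₂ (centre-adj-fresh w-fresh)) v≁w
      where
      v≁w : ¬ N′ v w
      v≁w v∼w with fresh-nbhd n<v v∼w
      ... | inj₁ w≡v = w≢v w≡v
      ... | inj₂ w≡n = <-irrefl (sym w≡n) (proj₁ w-fresh)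

    fresh-identified : ∀ {u v} → Fresh u → n < v → SameTrace E′ C′ u v → u ≡ v
    fresh-identified u-fresh n<v H with fresh-nbhd n<v (transfer H (fresh∈C′ u-fresh) (inj₁ refl))
    ... | inj₁ u≡v = u≡v
    ... | inj₂ u≡n = ⊥-elim (<-irrefl (sym u≡n) (proj₁ u-fresh))

    identified : ∀ {u v} → Place u → Place v → SameTrace E′ C′ u v → u ≡ v
    identified (old u<n)       (old v<n)       H = old-identified u<n v<n H
    identified (old u<n)       (centre refl)   H = ⊥-elim (centre≁old u<n (SameTrace-sym H))
    identified (old u<n)       (fresh v-fresh) H = ⊥-elim (fresh≁old v-fresh u<n (SameTrace-sym H))
    identified (centre refl)   (old v<n)       H = ⊥-elim (centre≁old v<n H)
    identified (centre refl)   (centre refl)   H = refl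
    identified (centre refl)   (fresh v-fresh) H = ⊥-elim (centre≁fresh v-fresh H)
    identified (fresh u-fresh) (old v<n)       H = ⊥-elim (fresh≁old u-fresh v<n H)
    identified (fresh u-fresh) (centre refl)   H = ⊥-elim (centre≁fresh u-fresh (SameTrace-sym H))
    identified (fresh u-fresh) (fresh v-fresh) H = fresh-identified u-fresh (proj₁ v-fresh) H

    dominated : ∀ {w} → Place w → ∃[ c ] (c ∈ C′ × N′ w c)
    dominated (old w<n) with C-dominating _ w<n
    ... | c , c∈ , w∼c = c , ∈-++⁺ˡ c∈ , lift-nbhd w∼c
    dominated (centre refl) = n + 1 , fresh∈C′ first-fresh , inj₂ (centre-adj-fresh first-fresh)
    dominated (fresh w-fresh) = _ , fresh∈C′ w-fresh , inj₁ refl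

    extended-code : IsIdentifyingCode (n + suc m) E′ C′
    extended-code =
        Unique.++⁺ C-unique (leaves-unique n m)
          (λ { (c∈C , c∈L) → <-asym (All.lookup C-below c∈C) (proj₁ (∈-leaves⁻ c∈L)) })
      , All.++⁺ (All.map old<order C-below) (All.tabulate (λ c∈ → fresh<order (proj₂ (∈-leaves⁻ c∈))))
      , (λ w w< → dominated (place w<))
      , (λ u v u< v< u≢v H → u≢v (identified (place u<) (place v<) H))

-- Two attached Δ-stars

module StarSeparation {E : Edges} {C : List ℕ} {centre spare : ℕ} (CodeLeaf : ℕ → Set)
  (leaf∈C : ∀ {k} → CodeLeaf k → k ∈ C)
  (centre∼leaf : ∀ {k} → CodeLeaf k → InClosedNbhd E centre k)
  (leaf-nbhd : ∀ {k c} → CodeLeaf k → InClosedNbhd E k c → c ≡ k ⊎ c ≡ centre)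
  (spare-nbhd : ∀ {c} → InClosedNbhd E spare c → c ≡ spare ⊎ c ≡ centre)
  (leaf≢centre : ∀ {k} → CodeLeaf k → k ≢ centre)
  (leaf≢spare : ∀ {k} → CodeLeaf k → k ≢ spare)
  {t₁ t₂ : ℕ} (t₁-leaf : CodeLeaf t₁) (t₂-leaf : CodeLeaf t₂) (t₁≢t₂ : t₁ ≢ t₂) where

  InStar : ℕ → Set
  InStar u = u ≡ centre ⊎ CodeLeaf u ⊎ u ≡ spare

  another-leaf : ∀ u → ∃[ t ] (CodeLeaf t × t ≢ u)
  another-leaf u with t₁ ≟ u
  ... | yes refl = t₂ , t₂-leaf , λ eq → t₁≢t₂ (sym eq)
  ... | no t₁≢u = t₁ , t₁-leaf , t₁≢u

  centre≁leaf : ∀ {k} → CodeLeaf k → ¬ SameTrace E C centre k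
  centre≁leaf {k} k-leaf with another-leaf k
  ... | t , t-leaf , t≢k = separated-by (leaf∈C t-leaf) (centre∼leaf t-leaf)
                             (λ k∼t → [ t≢k , leaf≢centre t-leaf ]′ (leaf-nbhd k-leaf k∼t))

  centre≁spare : ¬ SameTrace E C centre spare
  centre≁spare = separated-by (leaf∈C t₁-leaf) (centre∼leaf t₁-leaf)
                   (λ spare∼t₁ → [ leaf≢spare t₁-leaf , leaf≢centre t₁-leaf ]′ (spare-nbhd spare∼t₁))

  leaf-identified : ∀ {u v} → CodeLeaf u → InStar v → SameTrace E C u v → u ≡ v
  leaf-identified u-leaf (inj₁ refl) H = ⊥-elim (centre≁leaf u-leaf (SameTrace-sym H))
  leaf-identified u-leaf (inj₂ (inj₁ v-leaf)) H with leaf-nbhd v-leaf (transfer H (leaf∈C u-leaf) (inj₁ refl))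
  ... | inj₁ u≡v = u≡v
  ... | inj₂ u≡centre = ⊥-elim (leaf≢centre u-leaf u≡centre)
  leaf-identified u-leaf (inj₂ (inj₂ refl)) H =
    ⊥-elim ([ leaf≢spare u-leaf , leaf≢centre u-leaf ]′ (spare-nbhd (transfer H (leaf∈C u-leaf) (inj₁ refl))))

  star-identified : ∀ {u v} → InStar u → InStar v → SameTrace E C u v → u ≡ v
  star-identified (inj₂ (inj₁ u-leaf)) v-in H = leaf-identified u-leaf v-in H
  star-identified u-in (inj₂ (inj₁ v-leaf)) H = sym (leaf-identified v-leaf u-in (SameTrace-sym H))
  star-identified (inj₁ refl) (inj₁ refl) H = refl
  star-identified (inj₁ refl) (inj₂ (inj₂ refl)) H = ⊥-elim (centre≁spare H)
  star-identified (inj₂ (inj₂ refl)) (inj₁ refl) H = ⊥-elim (centre≁spare (SameTrace-sym H))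
  star-identified (inj₂ (inj₂ refl)) (inj₂ (inj₂ refl)) H = refl

record ThreeLeavesAvoiding (ℓ : ℕ) : Set where
  field
    spare first second : ℕ
    among-first-four : All (_∈ leaves 0 4) (spare ∷ first ∷ second ∷ [])
    distinct : Unique (ℓ ∷ spare ∷ first ∷ second ∷ [])

three-leaves-avoiding : ∀ {ℓ} → 1 ≤ ℓ → ThreeLeavesAvoiding ℓ
three-leaves-avoiding {1} _ = record
  { spare = 2 ; first = 3 ; second = 4
  ; among-first-four = there (here refl) ∷ there (there (here refl)) ∷ there (there (there (here refl))) ∷ []
  ; distinct = ((λ ()) ∷ (λ ()) ∷ (λ ()) ∷ []) ∷ ((λ ()) ∷ (λ ()) ∷ []) ∷ ((λ ()) ∷ []) ∷ [] ∷ [] }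
three-leaves-avoiding {2} _ = record
  { spare = 1 ; first = 3 ; second = 4
  ; among-first-four = here refl ∷ there (there (here refl)) ∷ there (there (there (here refl))) ∷ []
  ; distinct = ((λ ()) ∷ (λ ()) ∷ (λ ()) ∷ []) ∷ ((λ ()) ∷ (λ ()) ∷ []) ∷ ((λ ()) ∷ []) ∷ [] ∷ [] }
three-leaves-avoiding {3} _ = record
  { spare = 1 ; first = 2 ; second = 4
  ; among-first-four = here refl ∷ there (here refl) ∷ there (there (there (here refl))) ∷ []
  ; distinct = ((λ ()) ∷ (λ ()) ∷ (λ ()) ∷ []) ∷ ((λ ()) ∷ (λ ()) ∷ []) ∷ ((λ ()) ∷ []) ∷ [] ∷ [] }
three-leaves-avoiding {suc (suc (suc (suc _)))} _ = record
  { spare = 1 ; first = 2 ; second = 3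
  ; among-first-four = here refl ∷ there (here refl) ∷ there (there (here refl)) ∷ []
  ; distinct = ((λ ()) ∷ (λ ()) ∷ (λ ()) ∷ []) ∷ ((λ ()) ∷ (λ ()) ∷ []) ∷ ((λ ()) ∷ []) ∷ [] ∷ [] }

-- Δ = suc k = j + 2. S₀ is the star on 0, …, Δ, and S₁ has centre n = Δ + 1, anchor ℓ and fresh leaves
-- n + 1, …, n + k; the code leaves out ℓ, spare and n + k.
module TwoFullStars (j : ℕ) (2≤j : 2 ≤ j) (ℓ : ℕ) (1≤ℓ : 1 ≤ ℓ) (ℓ≤ : ℓ ≤ suc (suc j)) where

  k n : ℕ
  k = suc j
  n = suc (suc k)

  module S₀ = Append 0 [] [] (suc k) (λ ()) (λ ())
  module S₁ = Append n S₀.E′ ((n , ℓ) ∷ []) k S₀.edges-below (single-edge-from (s≤s ℓ≤))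
  open S₁ using (E′; N′)
  open ThreeLeavesAvoiding (three-leaves-avoiding 1≤ℓ)

  T R code : List ℕ
  T = without spare (without ℓ (leaves 0 (suc k)))
  R = leaves n j
  code = 0 ∷ n ∷ (T ++ R)

  ∈T⁺ : ∀ {x} → x ∈ leaves 0 (suc k) → x ≢ ℓ → x ≢ spare → x ∈ T
  ∈T⁺ x∈L x≢ℓ x≢spare = ∈-without⁺ (∈-without⁺ x∈L x≢ℓ) x≢spare

  ∈T⁻ : ∀ {x} → x ∈ T → x ∈ leaves 0 (suc k) × x ≢ ℓ × x ≢ spare
  ∈T⁻ x∈ with ∈-without⁻ x∈
  ... | x∈′ , x≢spare with ∈-without⁻ x∈′
  ... | x∈L , x≢ℓ = x∈L , x≢ℓ , x≢spare

  ⊆-first-leaves : ∀ {x} → x ∈ leaves 0 4 → x ∈ leaves 0 (suc k)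
  ⊆-first-leaves x∈ with ∈-leaves⁻ {0} x∈
  ... | 0<x , x≤4 = ∈-leaves⁺ {0} 0<x (≤-trans x≤4 (s≤s (s≤s 2≤j)))

  spare-leaf : spare ∈ leaves 0 (suc k) × spare ≢ ℓ
  spare-leaf with among-first-four | distinct
  ... | s∈ ∷ _ | (ℓ≢s ∷ _) ∷ _ = ⊆-first-leaves s∈ , ≢-sym ℓ≢s

  two-code-leaves : first ∈ T × second ∈ T × first ≢ second
  two-code-leaves with among-first-four | distinct
  ... | _ ∷ f∈ ∷ t∈ ∷ [] | (_ ∷ ℓ≢f ∷ ℓ≢t ∷ []) ∷ (s≢f ∷ s≢t ∷ []) ∷ (f≢t ∷ []) ∷ _ =
    ∈T⁺ (⊆-first-leaves f∈) (≢-sym ℓ≢f) (≢-sym s≢f) , ∈T⁺ (⊆-first-leaves t∈) (≢-sym ℓ≢t) (≢-sym s≢t) , f≢t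

  length-T : suc (suc (length T)) ≤ suc k
  length-T = begin
    suc (suc (length T))                        ≤⟨ s≤s (length-without (∈-without⁺ (proj₁ spare-leaf) (proj₂ spare-leaf))) ⟩
    suc (length (without ℓ (leaves 0 (suc k)))) ≤⟨ length-without (∈-leaves⁺ 1≤ℓ ℓ≤) ⟩
    length (leaves 0 (suc k))                   ≡⟨ length-leaves 0 (suc k) ⟩
    suc k                                       ∎
    where open ≤-Reasoning

  first-leaf-bounds : ∀ {x} → x ∈ leaves 0 (suc k) → 0 < x × x < n
  first-leaf-bounds x∈L with ∈-leaves⁻ {0} x∈L
  ... | 0<x , x≤ = 0<x , s≤s x≤

  first-leaf-nbhd : ∀ {x c} → x ∈ leaves 0 (suc k) → x ≢ ℓ → N′ x c → c ≡ x ⊎ c ≡ 0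
  first-leaf-nbhd x∈L x≢ℓ x∼c with first-leaf-bounds x∈L
  ... | 0<x , x<n with S₁.old-nbhd⁻ x<n x∼c
  ... | inj₁ x∼₀c = S₀.fresh-nbhd 0<x x∼₀c
  ... | inj₂ (_ , here eq) = ⊥-elim (x≢ℓ (cong proj₂ eq))

  T-bounds : ∀ {x} → x ∈ T → 0 < x × x < n
  T-bounds x∈T = first-leaf-bounds (proj₁ (∈T⁻ x∈T))

  T-nbhd : ∀ {x c} → x ∈ T → N′ x c → c ≡ x ⊎ c ≡ 0
  T-nbhd x∈T = first-leaf-nbhd (proj₁ (∈T⁻ x∈T)) (proj₁ (proj₂ (∈T⁻ x∈T)))

  spare-nbhd : ∀ {c} → N′ spare c → c ≡ spare ⊎ c ≡ 0
  spare-nbhd = first-leaf-nbhd (proj₁ spare-leaf) (proj₂ spare-leaf)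

  sees-first-centre : ∀ {w} → w < n → N′ w 0
  sees-first-centre {zero} _ = inj₁ refl
  sees-first-centre {suc w} w<n = nbhd-sym (S₁.lift-nbhd (inj₂ (S₀.centre-adj-fresh (s≤s z≤n , ≤-pred w<n))))

  sees-first-centre⁻ : ∀ {w} → N′ w 0 → w < n
  sees-first-centre⁻ w∼0 with S₁.old-nbhd⁻ (s≤s z≤n) (nbhd-sym w∼0)
  ... | inj₁ 0∼₀w = nbhd-below S₀.edges-below (s≤s z≤n) 0∼₀w
  ... | inj₂ (_ , here eq) = ⊥-elim (<-irrefl (cong proj₂ eq) 1≤ℓ)

  ℓ-sees-second-centre : N′ ℓ n
  ℓ-sees-second-centre = nbhd-sym (inj₂ (S₁.centre-adj-X (here refl)))

  sees-second-centre : ∀ {w} → n ≤ w → w < n + suc k → N′ w n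
  sees-second-centre n≤w w< with S₁.place w<
  ... | S₁.old w<n = ⊥-elim (<⇒≱ w<n n≤w)
  ... | S₁.centre w≡n = inj₁ (sym w≡n)
  ... | S₁.fresh w-fresh = nbhd-sym (inj₂ (S₁.centre-adj-fresh w-fresh))

  sees-second-centre⁻ : ∀ {w} → w < n → N′ w n → w ≡ ℓ
  sees-second-centre⁻ w<n w∼n with S₁.old-nbhd⁻ w<n w∼n
  ... | inj₁ w∼₀n = ⊥-elim (<-irrefl refl (nbhd-below S₀.edges-below w<n w∼₀n))
  ... | inj₂ (_ , here eq) = cong proj₂ eq

  SecondLeaf : ℕ → Set
  SecondLeaf y = n < y × y ≤ n + j

  n+j<n+k : n + j < n + k
  n+j<n+k = +-monoʳ-< n (n<1+n j)

  second-leaf : ∀ {i} → 0 < i → i ≤ j → SecondLeaf (n + i)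
  second-leaf 0<i i≤j = m<m+n n 0<i , +-monoʳ-≤ n i≤j

  module First = StarSeparation {E′} {code} {0} {spare} (_∈ T)
    (λ x∈T → there (there (∈-++⁺ˡ x∈T)))
    (λ x∈T → nbhd-sym (sees-first-centre (proj₂ (T-bounds x∈T))))
    T-nbhd
    spare-nbhd
    (λ x∈T x≡0 → <-irrefl (sym x≡0) (proj₁ (T-bounds x∈T)))
    (λ x∈T → proj₂ (proj₂ (∈T⁻ x∈T)))
    (proj₁ two-code-leaves) (proj₁ (proj₂ two-code-leaves)) (proj₂ (proj₂ two-code-leaves))

  module Second = StarSeparation {E′} {code} {n} {n + k} SecondLeaf
    (λ (n<y , y≤) → there (there (∈-++⁺ʳ T (∈-leaves⁺ n<y y≤))))
    (λ (n<y , y≤) → inj₂ (S₁.centre-adj-fresh (n<y , ≤-trans y≤ (<⇒≤ n+j<n+k))))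
    (λ (n<y , _) → S₁.fresh-nbhd n<y)
    (S₁.fresh-nbhd (≤-<-trans (m≤m+n n j) n+j<n+k))
    (λ (n<y , _) y≡n → <-irrefl (sym y≡n) n<y)
    (λ (_ , y≤) y≡n+k → <-irrefl y≡n+k (≤-<-trans y≤ n+j<n+k))
    (second-leaf (s≤s z≤n) (≤-trans (s≤s z≤n) 2≤j)) (second-leaf (s≤s z≤n) 2≤j)
    (λ eq → 1+n≢n (sym (+-cancelˡ-≡ n 1 2 eq)))

  in-first-star : ∀ {u} → u < n → u ≢ ℓ → First.InStar u
  in-first-star {u} u<n u≢ℓ with u ≟ 0 | u ≟ spare
  ... | yes u≡0 | _           = inj₁ u≡0
  ... | no _    | yes u≡spare = inj₂ (inj₂ u≡spare)
  ... | no u≢0  | no u≢spare  = inj₂ (inj₁ (∈T⁺ (∈-leaves⁺ (n≢0⇒n>0 u≢0) (≤-pred u<n)) u≢ℓ u≢spare))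

  in-second-star : ∀ {u} → n ≤ u → u < n + suc k → Second.InStar u
  in-second-star {u} n≤u u< with S₁.place u<
  ... | S₁.old u<n = ⊥-elim (<⇒≱ u<n n≤u)
  ... | S₁.centre u≡n = inj₁ u≡n
  ... | S₁.fresh (n<u , u≤n+k) with m≤n⇒m<n∨m≡n u≤n+k
  ... | inj₁ u<n+k = inj₂ (inj₁ (n<u , ≤-pred (subst (u <_) (+-suc n j) u<n+k)))
  ... | inj₂ u≡n+k = inj₂ (inj₂ u≡n+k)

  first-identified : ∀ {u v} → u < n → v < n → SameTrace E′ code u v → u ≡ v
  first-identified {u} {v} u<n v<n H with u ≟ ℓ | v ≟ ℓ
  ... | yes refl | yes refl = refl
  ... | yes refl | no v≢ℓ = ⊥-elim (v≢ℓ (sees-second-centre⁻ v<n (transfer H (there (here refl)) ℓ-sees-second-centre)))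
  ... | no u≢ℓ | yes refl = ⊥-elim (u≢ℓ (sees-second-centre⁻ u<n (transfer (SameTrace-sym H) (there (here refl)) ℓ-sees-second-centre)))
  ... | no u≢ℓ | no v≢ℓ = First.star-identified (in-first-star u<n u≢ℓ) (in-first-star v<n v≢ℓ) H

  identified : ∀ {u v} → u < n + suc k → v < n + suc k → SameTrace E′ code u v → u ≡ v
  identified {u} {v} u< v< H with u <? n | v <? n
  ... | yes u<n | yes v<n = first-identified u<n v<n H
  ... | yes u<n | no v≮n = ⊥-elim (v≮n (sees-first-centre⁻ (transfer H (here refl) (sees-first-centre u<n))))
  ... | no u≮n | yes v<n = ⊥-elim (u≮n (sees-first-centre⁻ (transfer (SameTrace-sym H) (here refl) (sees-first-centre v<n))))
  ... | no u≮n | no v≮n = Second.star-identified (in-second-star (≮⇒≥ u≮n) u<) (in-second-star (≮⇒≥ v≮n) v<) H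

  dominated : ∀ {w} → w < n + suc k → ∃[ c ] (c ∈ code × N′ w c)
  dominated {w} w< with w <? n
  ... | yes w<n = 0 , here refl , sees-first-centre w<n
  ... | no w≮n = n , there (here refl) , sees-second-centre (≮⇒≥ w≮n) w<

  code-leaf-bounds : ∀ {c} → c ∈ T ++ R → (0 < c × c < n) ⊎ (n < c × c ≤ n + j)
  code-leaf-bounds c∈ with ∈-++⁻ T c∈
  ... | inj₁ c∈T = inj₁ (T-bounds c∈T)
  ... | inj₂ c∈R = inj₂ (∈-leaves⁻ c∈R)

  code-unique : Unique code
  code-unique = All.tabulate 0≢ ∷ All.tabulate n≢ ∷ Unique.++⁺ T-unique (leaves-unique n j) T∩R≡∅
    where
    0≢ : ∀ {c} → c ∈ n ∷ T ++ R → 0 ≢ c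
    0≢ (here refl) ()
    0≢ (there c∈) 0≡c with code-leaf-bounds c∈
    ... | inj₁ (0<c , _) = <-irrefl 0≡c 0<c
    ... | inj₂ (n<c , _) = <-irrefl 0≡c (<-trans (s≤s z≤n) n<c)
    n≢ : ∀ {c} → c ∈ T ++ R → n ≢ c
    n≢ c∈ n≡c with code-leaf-bounds c∈
    ... | inj₁ (_ , c<n) = <-irrefl (sym n≡c) c<n
    ... | inj₂ (n<c , _) = <-irrefl n≡c n<c
    T-unique : Unique T
    T-unique = without-unique {spare} (without-unique {ℓ} (leaves-unique 0 (suc k)))
    T∩R≡∅ : ∀ {c} → ¬ (c ∈ T × c ∈ R)
    T∩R≡∅ (c∈T , c∈R) = <-asym (proj₂ (T-bounds c∈T)) (proj₁ (∈-leaves⁻ c∈R))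

  code-below : All (_< n + suc k) code
  code-below = S₁.old<order (s≤s z≤n) ∷ S₁.n<order ∷ All.tabulate (λ c∈ → below (code-leaf-bounds c∈))
    where
    below : ∀ {c} → (0 < c × c < n) ⊎ (n < c × c ≤ n + j) → c < n + suc k
    below (inj₁ (_ , c<n)) = S₁.old<order c<n
    below (inj₂ (_ , c≤)) = S₁.fresh<order (≤-trans c≤ (<⇒≤ n+j<n+k))

  is-code : IsIdentifyingCode (n + suc k) E′ code
  is-code = code-unique , code-below , (λ w w< → dominated w<) , (λ u v u< v< u≢v H → u≢v (identified u< v< H))

  length-code : length code ≤ k + k
  length-code = begin
    suc (suc (length (T ++ R))) ≡⟨ cong (λ x → suc (suc x)) (trans (length-++ T) (cong (length T +_) (length-leaves n j))) ⟩
    suc (suc (length T + j))    ≤⟨ +-monoˡ-≤ j length-T ⟩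
    suc k + j                   ≡⟨ sym (+-suc k j) ⟩
    k + k                       ∎
    where open ≤-Reasoning

WithinRatio : ℕ → ℕ → ℕ → Set
WithinRatio k c n = c * suc k ≤ k * n

ratio-+ : ∀ {k a b c d} → WithinRatio k a b → WithinRatio k c d → WithinRatio k (a + c) (b + d)
ratio-+ {k} {a} {b} {c} {d} a/b c/d = begin
  (a + c) * suc k       ≡⟨ *-distribʳ-+ (suc k) a c ⟩
  a * suc k + c * suc k ≤⟨ +-mono-≤ a/b c/d ⟩
  k * b + k * d         ≡⟨ sym (*-distribˡ-+ k b d) ⟩
  k * (b + d)           ∎
  where open ≤-Reasoning

ratio-≤ : ∀ {k x y} → x ≤ k * y → WithinRatio k x (y + x)
ratio-≤ {k} {x} {y} x≤ky = begin
  x * suc k     ≡⟨ *-suc x k ⟩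
  x + x * k     ≤⟨ +-monoˡ-≤ (x * k) x≤ky ⟩
  k * y + x * k ≡⟨ cong (k * y +_) (*-comm x k) ⟩
  k * y + k * x ≡⟨ sym (*-distribˡ-+ k y x) ⟩
  k * (y + x)   ∎
  where open ≤-Reasoning

ratio-mono : ∀ {k c c′ n n′} → c ≤ c′ → n′ ≤ n → WithinRatio k c′ n′ → WithinRatio k c n
ratio-mono {k} c≤c′ n′≤n r = ≤-trans (*-monoˡ-≤ (suc k) c≤c′) (≤-trans r (*-monoʳ-≤ k n′≤n))

sequence-edges-below : ∀ {p n E} → AppendedStarSeq p n E → EdgesBelow n E
sequence-edges-below (base d _) = Append.edges-below 0 [] [] d (λ ()) (λ ())
sequence-edges-below (append s zero () v v<n)
sequence-edges-below (append {n = n} {E = E} s (suc e) _ v v<n) =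
  Append.edges-below n E ((n , v) ∷ []) e (sequence-edges-below s) (single-edge-from v<n)

star-code : ∀ {d} → 2 ≤ d → IsIdentifyingCode (suc d) (starFrom 0 d) (leaves 0 d)
star-code {d} = Append.Extend.extended-code 0 [] [] d (λ ()) (λ ()) empty-code

attach-star-code : ∀ {n E C v e} → EdgesBelow n E → v < n → 2 ≤ e → IsIdentifyingCode n E C →
  IsIdentifyingCode (n + suc e) (E ++ ((n , v) ∷ starFrom n e)) (C ++ leaves n e)
attach-star-code {n} {E} {v = v} {e} below v<n 2≤e code =
  Append.Extend.extended-code n E ((n , v) ∷ []) e below (single-edge-from v<n) code 2≤e

length-++-leaves : ∀ C n e → length (C ++ leaves n e) ≡ length C + e
length-++-leaves C n e = trans (length-++ C) (cong (length C +_) (length-leaves n e))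

double≡*2 : ∀ k → k + k ≡ k * 2
double≡*2 = solve-∀

sum-≤-unless-both-max : ∀ {x y k} → x ≤ suc k → y ≤ k → ¬ (x ≡ suc k × y ≡ k) → x + y ≤ k + k
sum-≤-unless-both-max {x} {y} {k} x≤ y≤ not-both with x ≟ suc k
... | no x≢ = +-mono-≤ (≤-pred (≤∧≢⇒< x≤ x≢)) y≤
... | yes refl = begin
  suc k + y ≡⟨ sym (+-suc k y) ⟩
  k + suc y ≤⟨ +-monoʳ-≤ k (≤∧≢⇒< y≤ (λ y≡k → not-both (refl , y≡k))) ⟩
  k + k     ∎
  where open ≤-Reasoning

attached-leaves-≤ : ∀ {k n} E v {e} → (∀ w → w < n + suc e → degree (E ++ ((n , v) ∷ starFrom n e)) w ≤ suc k) → e ≤ k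
attached-leaves-≤ {n = n} E v {e} deg≤ = ≤-pred (≤-trans (degree-attached-centre E e) (deg≤ n (m<m+n n (s≤s z≤n))))

anchor-is-leaf : ∀ {d n v F} → degree (starFrom 0 d ++ ((n , v) ∷ F)) 0 ≤ d → 1 ≤ v
anchor-is-leaf {v = suc _} _ = s≤s z≤n
anchor-is-leaf {d} {n} {zero} {F} deg≤d = ⊥-elim (1+n≰n (begin
  suc d                                   ≡⟨ cong suc (sym (degree-starFrom 0 d)) ⟩
  suc (degree (starFrom 0 d) 0)           ≤⟨ degree-attached-anchor (starFrom 0 d) {n} F ⟩
  degree (starFrom 0 d ++ ((n , 0) ∷ F)) 0 ≤⟨ deg≤d ⟩
  d                                       ∎))
  where open ≤-Reasoning

StarPair : ℕ → ℕ → ℕ → Edges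
StarPair d₀ v e = starFrom 0 d₀ ++ ((suc d₀ , v) ∷ starFrom (suc d₀) e)

star-pair-code : ∀ k {d₀ v e} → 3 ≤ k → 3 ≤ d₀ → v < suc d₀ → 2 ≤ e →
  (∀ w → w < suc d₀ + suc e → degree (StarPair d₀ v e) w ≤ suc k) →
  ∃[ C ] (IsIdentifyingCode (suc d₀ + suc e) (StarPair d₀ v e) C × WithinRatio k (length C) (suc d₀ + suc e))
star-pair-code k {d₀} {v} {e} 3≤k 3≤d₀ v<n 2≤e deg≤ with (d₀ ≟ suc k) ×-dec (e ≟ k)
star-pair-code (suc j) 3≤k 3≤d₀ v<n 2≤e deg≤ | yes (refl , refl) =
  code , is-code , ratio-mono length-code (s≤s (s≤s (+-monoʳ-≤ (suc j) (n≤1+n (suc j)))))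
                              (ratio-≤ (≤-reflexive (double≡*2 (suc j))))
  where open TwoFullStars j (≤-pred 3≤k) _ (anchor-is-leaf (deg≤ 0 (s≤s z≤n))) (≤-pred v<n)
... | no not-both-full =
  leaves 0 d₀ ++ leaves (suc d₀) e ,
  attach-star-code (sequence-edges-below (base d₀ 3≤d₀)) v<n 2≤e (star-code (≤-trans (n≤1+n 2) 3≤d₀)) ,
  subst₂ (WithinRatio k) (sym length≡) (cong suc (sym (+-suc d₀ e)))
         (ratio-≤ (≤-trans (sum-≤-unless-both-max d₀≤ (attached-leaves-≤ (starFrom 0 d₀) v deg≤) not-both-full) (≤-reflexive (double≡*2 k))))
  where
  d₀≤ : d₀ ≤ suc k
  d₀≤ = ≤-trans (≤-reflexive (sym (degree-starFrom 0 d₀))) (≤-trans (degree-++ˡ (starFrom 0 d₀) _ 0) (deg≤ 0 (s≤s z≤n)))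
  length≡ : length (leaves 0 d₀ ++ leaves (suc d₀) e) ≡ d₀ + e
  length≡ = trans (length-++-leaves (leaves 0 d₀) (suc d₀) e) (cong (_+ e) (length-leaves 0 d₀))

appended-star-code : ∀ k {p n E} → 3 ≤ k → AppendedStarSeq (suc p) n E → (∀ v → v < n → degree E v ≤ suc k) →
  ∃[ C ] (IsIdentifyingCode n E C × WithinRatio k (length C) n)
appended-star-code k 3≤k (append s zero () v v<n) deg≤
appended-star-code k 3≤k (append (base d₀ 3≤d₀) (suc e) 3≤d v v<n) deg≤ =
  star-pair-code k 3≤k 3≤d₀ v<n (≤-pred 3≤d) deg≤
appended-star-code k 3≤k (append {suc p} {n} {E} s (suc e) 3≤d v v<n) deg≤
  with appended-star-code k 3≤k s (λ w w<n → ≤-trans (degree-++ˡ E _ w) (deg≤ w (<-≤-trans w<n (m≤m+n n (suc e)))))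
... | C , code , ratio =
  C ++ leaves n e ,
  attach-star-code (sequence-edges-below s) v<n (≤-pred 3≤d) code ,
  subst (λ c → WithinRatio k c (n + suc e)) (sym (length-++-leaves C n e))
        (ratio-+ {k} {length C} {n} ratio (ratio-≤ {k} {e} {1} (≤-trans (attached-leaves-≤ E v deg≤) (≤-reflexive (sym (*-identityʳ k))))))

lemma4p12 : (n Δ : ℕ) (E : Edges) → AppendedStar n E → MaxDegree n E Δ → 4 ≤ Δ →
    ∃[ C ] (IsIdentifyingCode n E C × length C * Δ ≤ (Δ ∸ 1) * n)
lemma4p12 n Δ E (zero , () , _) _ _
lemma4p12 n (suc k) E (suc p , _ , s) (deg≤ , _) (s≤s 3≤k) = appended-star-code k 3≤k s deg≤
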